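{- If a hypersequent $H$ has a cut-free derivation in $\mathrm{RS4}$, then $H$ is valid in all $\mathrm{PS4}$ models.
   Context: Sequents $\Gamma\Rightarrow\Delta$ are pairs of finite sets of formulas (atoms, $\neg,\Box,\land,\lor$); hypersequents $S_1\,/\!/\,\dots\,/\!/\,S_n$ are finite lists of sequents. $\mathrm{RS4}$ consists of: axiom $p\Rightarrow p$; Cut; external weakening at the ends ($G$ to $\Rightarrow\,/\!/\,G$, $G$ to $G\,/\!/\,\Rightarrow$); internal weakening in any component; the usual sequent rules for $\neg,\land,\lor$ inside any component; $\Box\mathrm{R}$: from $G\,/\!/\,\Gamma\Rightarrow\Delta\,/\!/\,\Rightarrow\phi$ infer $G\,/\!/\,\Gamma\Rightarrow\Box\phi,\Delta$; $\Box\mathrm{L}$: from $G\,/\!/\,\Gamma\Rightarrow\Delta\,/\!/\,\Sigma,\phi\Rightarrow\Lambda\,/\!/\,H$ infer $G\,/\!/\,\Gamma,\Box\phi\Rightarrow\Delta\,/\!/\,\Sigma\Rightarrow\Lambda\,/\!/\,H$; $EC$: from $G\,/\!/\,\Gamma\Rightarrow\Delta\,/\!/\,\Gamma\Rightarrow\Delta\,/\!/\,H$ infer $G\,/\!/\,\Gamma\Rightarrow\Delta\,/\!/\,H$; $EW$: from $G\,/\!/\,H$ infer $G\,/\!/\,\Rightarrow\,/\!/\,H$. A $\mathrm{PS4}$ model is $\langle W,R,S,v\rangle$ with $R,S$ reflexive, (Pseudo-Transitivity) $xRy,yRz$ imply some $w$ with $xRw$, $zSw$; (Forth) $xRy,xSz$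 imply some $w$ with $zRw$, $ySw$; (Back) $xSz,zRw$ imply some $y$ with $xRy$, $ySw$; $v$ three-valued ($1,*,0$) Strong Kleene with $\Box\phi$ true at $x$ iff $\phi$ true at all $R$-successors and false iff $\phi$ false at some $R$-successor; and if $xSy$ then every atom with value in $\{1,0\}$ at $x$ has the same value at $y$. A $\mathrm{PS4}$ model is a countermodel to $\Gamma_1\Rightarrow\Delta_1\,/\!/\,\dots\,/\!/\,\Gamma_n\Rightarrow\Delta_n$ if there is a branch $w_1,\dots,w_n$ ($w_iRw_{i+1}$) with every formula of $\Gamma_i$ having value 1 and every formula of $\Delta_i$ value 0 at $w_i$; $H$ is $\mathrm{PS4}$-valid if it has no countermodel. -}

module Defs where

open import Data.Nat using (ℕ)
open import Data.List using (List; []; _∷_; _++_; [_])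
open import Data.List.Membership.Propositional using (_∈_)
open import Data.List.Relation.Binary.Subset.Propositional using (_⊆_)
open import Data.List.Relation.Binary.Pointwise using (Pointwise)
open import Data.Product using (Σ; _×_; _,_)
open import Data.Sum using (_⊎_)
open import Data.Unit using (⊤)
open import Data.Empty using (⊥)
open import Relation.Nullary using (¬_)
open import Relation.Binary.PropositionalEquality using (_≡_)

Atom : Set
Atom = ℕ

data Fml : Set where
  atom : Atom → Fml
  ¬'_  : Fml → Fml
  □_   : Fml → Fml
  _∧'_ : Fml → Fml → Fml
  _∨'_ : Fml → Fml → Fml

-- A sequent Γ ⇒ Δ: pairs of finite sets of formulas, represented by lists
-- taken up to set equality (see the rule `set-eq` below).
record Sequent : Set where
  constructor _⇒_
  field
    ant : List Fml
    suc : List Fml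
open Sequent public

HS : Set
HS = List Sequent

_≋_ : List Fml → List Fml → Set
Γ ≋ Δ = (Γ ⊆ Δ) × (Δ ⊆ Γ)

_≈S_ : Sequent → Sequent → Set
(Γ ⇒ Δ) ≈S (Γ' ⇒ Δ') = (Γ ≋ Γ') × (Δ ≋ Δ')

_≈H_ : HS → HS → Set
G ≈H H = Pointwise _≈S_ G H

-- The calculus RS4.  "Γ , φ" is written  φ ∷ Γ.
-- G ++ [ S ] ++ H  is the hypersequent  G // S // H.

infix 4 ⊢_

data ⊢_ : HS → Set where
  set-eq : ∀ {G H} → G ≈H H → ⊢ G → ⊢ H
  ax     : ∀ p → ⊢ [ (atom p ∷ []) ⇒ (atom p ∷ []) ]
  cut    : ∀ G H Γ Δ φ →
           ⊢ G ++ [ Γ ⇒ (φ ∷ Δ) ] ++ H →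
           ⊢ G ++ [ (φ ∷ Γ) ⇒ Δ ] ++ H →
           ⊢ G ++ [ Γ ⇒ Δ ] ++ H
  ewL    : ∀ G → ⊢ G → ⊢ ([] ⇒ []) ∷ G
  ewR    : ∀ G → ⊢ G → ⊢ G ++ [ [] ⇒ [] ]
  iwL    : ∀ G H Γ Δ φ → ⊢ G ++ [ Γ ⇒ Δ ] ++ H → ⊢ G ++ [ (φ ∷ Γ) ⇒ Δ ] ++ H
  iwR    : ∀ G H Γ Δ φ → ⊢ G ++ [ Γ ⇒ Δ ] ++ H → ⊢ G ++ [ Γ ⇒ (φ ∷ Δ) ] ++ H
  ¬L     : ∀ G H Γ Δ φ → ⊢ G ++ [ Γ ⇒ (φ ∷ Δ) ] ++ H → ⊢ G ++ [ ((¬' φ) ∷ Γ) ⇒ Δ ] ++ H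
  ¬R     : ∀ G H Γ Δ φ → ⊢ G ++ [ (φ ∷ Γ) ⇒ Δ ] ++ H → ⊢ G ++ [ Γ ⇒ ((¬' φ) ∷ Δ) ] ++ H
  ∧L     : ∀ G H Γ Δ φ ψ → ⊢ G ++ [ (φ ∷ ψ ∷ Γ) ⇒ Δ ] ++ H
           → ⊢ G ++ [ ((φ ∧' ψ) ∷ Γ) ⇒ Δ ] ++ H
  ∧R     : ∀ G H Γ Δ φ ψ → ⊢ G ++ [ Γ ⇒ (φ ∷ Δ) ] ++ H → ⊢ G ++ [ Γ ⇒ (ψ ∷ Δ) ] ++ H
           → ⊢ G ++ [ Γ ⇒ ((φ ∧' ψ) ∷ Δ) ] ++ H
  ∨L     : ∀ G H Γ Δ φ ψ → ⊢ G ++ [ (φ ∷ Γ) ⇒ Δ ] ++ H → ⊢ G ++ [ (ψ ∷ Γ) ⇒ Δ ] ++ H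
           → ⊢ G ++ [ ((φ ∨' ψ) ∷ Γ) ⇒ Δ ] ++ H
  ∨R     : ∀ G H Γ Δ φ ψ → ⊢ G ++ [ Γ ⇒ (φ ∷ ψ ∷ Δ) ] ++ H
           → ⊢ G ++ [ Γ ⇒ ((φ ∨' ψ) ∷ Δ) ] ++ H
  □R     : ∀ G Γ Δ φ → ⊢ G ++ [ Γ ⇒ Δ ] ++ [ [] ⇒ (φ ∷ []) ]
           → ⊢ G ++ [ Γ ⇒ ((□ φ) ∷ Δ) ]
  □L     : ∀ G H Γ Δ Σ' Λ φ → ⊢ G ++ [ Γ ⇒ Δ ] ++ [ (φ ∷ Σ') ⇒ Λ ] ++ H
           → ⊢ G ++ [ ((□ φ) ∷ Γ) ⇒ Δ ] ++ [ Σ' ⇒ Λ ] ++ H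
  EC     : ∀ G H Γ Δ → ⊢ G ++ [ Γ ⇒ Δ ] ++ [ Γ ⇒ Δ ] ++ H → ⊢ G ++ [ Γ ⇒ Δ ] ++ H
  EW     : ∀ G H → ⊢ G ++ H → ⊢ G ++ [ [] ⇒ [] ] ++ H

CutFree : ∀ {H} → ⊢ H → Set
CutFree (set-eq _ d)          = CutFree d
CutFree (ax _)                = ⊤
CutFree (cut _ _ _ _ _ _ _)   = ⊥
CutFree (ewL _ d)             = CutFree d
CutFree (ewR _ d)             = CutFree d
CutFree (iwL _ _ _ _ _ d)     = CutFree d
CutFree (iwR _ _ _ _ _ d)     = CutFree d
CutFree (¬L _ _ _ _ _ d)      = CutFree d
CutFree (¬R _ _ _ _ _ d)      = CutFree d
CutFree (∧L _ _ _ _ _ _ d)    = CutFree d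
CutFree (∧R _ _ _ _ _ _ d e)  = CutFree d × CutFree e
CutFree (∨L _ _ _ _ _ _ d e)  = CutFree d × CutFree e
CutFree (∨R _ _ _ _ _ _ d)    = CutFree d
CutFree (□R _ _ _ _ d)        = CutFree d
CutFree (□L _ _ _ _ _ _ _ d)  = CutFree d
CutFree (EC _ _ _ _ d)        = CutFree d
CutFree (EW _ _ d)            = CutFree d

data V3 : Set where
  one star zero : V3

record PS4Model : Set₁ where
  field
    W : Set
    R : W → W → Set
    S : W → W → Set
    v : W → Atom → V3
    R-refl : ∀ x → R x x
    S-refl : ∀ x → S x x
    pseudoTrans : ∀ {x y z} → R x y → R y z → Σ W λ w → R x w × S z w
    forth : ∀ {x y z} → R x y → S x z → Σ W λ w → R z w × S y w
    back  : ∀ {x z w} → S x z → R z w → Σ W λ y → R x y × S y w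
    persist1 : ∀ {x y} p → S x y → v x p ≡ one  → v y p ≡ one
    persist0 : ∀ {x y} p → S x y → v x p ≡ zero → v y p ≡ zero

module _ (M : PS4Model) where
  open PS4Model M

  -- Strong Kleene: ⊨1 x φ  means φ has value 1 at x, ⊨0 x φ means value 0.
  ⊨1 ⊨0 : W → Fml → Set
  ⊨1 x (atom p) = v x p ≡ one
  ⊨1 x (¬' φ)   = ⊨0 x φ
  ⊨1 x (□ φ)    = ∀ y → R x y → ⊨1 y φ
  ⊨1 x (φ ∧' ψ) = ⊨1 x φ × ⊨1 x ψ
  ⊨1 x (φ ∨' ψ) = ⊨1 x φ ⊎ ⊨1 x ψ
  ⊨0 x (atom p) = v x p ≡ zero
  ⊨0 x (¬' φ)   = ⊨1 x φ
  ⊨0 x (□ φ)    = Σ W λ y → R x y × ⊨0 y φ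
  ⊨0 x (φ ∧' ψ) = ⊨0 x φ ⊎ ⊨0 x ψ
  ⊨0 x (φ ∨' ψ) = ⊨0 x φ × ⊨0 x ψ

  RefutesSeq : W → Sequent → Set
  RefutesSeq w (Γ ⇒ Δ) = (∀ φ → φ ∈ Γ → ⊨1 w φ) × (∀ φ → φ ∈ Δ → ⊨0 w φ)

  RefutesFrom : W → Sequent → HS → Set
  RefutesFrom w s []       = RefutesSeq w s
  RefutesFrom w s (t ∷ H)  = RefutesSeq w s × Σ W λ w' → R w w' × RefutesFrom w' t H

  Countermodel : HS → Set
  Countermodel []      = ⊤
  Countermodel (s ∷ H) = Σ W λ w → RefutesFrom w s H

PS4Valid : HS → Set₁
PS4Valid H = ∀ (M : PS4Model) → ¬ Countermodel M H

{-# OPTIONS --safe #-}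
-- Soundness, proved contrapositively: reading each rule upwards, a countermodel
-- of its conclusion is turned into a countermodel of one of its premises, so a
-- cut-free derivation would end in a refuted axiom p ⇒ p, which is impossible
-- since p cannot be both 1 and 0.  Forth and Back make the values 1 and 0 of all
-- formulas persistent along S, which is what external weakening needs.  Cut is
-- the one rule this fails for: when the cut formula has value *, a countermodel
-- of the conclusion refutes neither premise.
module Submission where

open import Defs
open import Data.Product using (Σ; _,_)
open import Data.Sum using (_⊎_; inj₁; inj₂; reduce) renaming (map to ⊎-map)
open import Data.List using (List; []; _∷_; _++_; [_])
open import Data.List.Properties using (++-identityʳ)
open import Data.List.Relation.Unary.Any using (here; there)
open import Data.List.Membership.Propositional using (_∈_)
open import Data.List.Relation.Binary.Pointwise using ([]; _∷_)
open import Data.Unit using (tt)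
open import Data.Empty using (⊥)
open import Function using (_∘_)
open import Relation.Binary.PropositionalEquality using (_≢_; refl; sym; trans; subst)

module _ {a p} {A : Set a} {P : A → Set p} {x : A} {xs : List A} where

  ∀∈-head : (∀ y → y ∈ x ∷ xs → P y) → P x
  ∀∈-head f = f x (here refl)

  ∀∈-tail : (∀ y → y ∈ x ∷ xs → P y) → ∀ y → y ∈ xs → P y
  ∀∈-tail f y y∈xs = f y (there y∈xs)

  ∀∈-cons : P x → (∀ y → y ∈ xs → P y) → ∀ y → y ∈ x ∷ xs → P y
  ∀∈-cons px f _ (here refl)  = px
  ∀∈-cons px f y (there y∈xs) = f y y∈xs

one≢zero : one ≢ zero
one≢zero ()

module Soundness (M : PS4Model) where
  open PS4Model M

  mutual
    ⊨1-persist : ∀ {x y} φ → S x y → ⊨1 M x φ → ⊨1 M y φ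
    ⊨1-persist (atom p) xSy t = persist1 p xSy t
    ⊨1-persist (¬' φ)   xSy t = ⊨0-persist φ xSy t
    ⊨1-persist (□ φ)    xSy t z yRz =
      let (u , xRu , uSz) = back xSy yRz in ⊨1-persist φ uSz (t u xRu)
    ⊨1-persist (φ ∧' ψ) xSy (tφ , tψ) = ⊨1-persist φ xSy tφ , ⊨1-persist ψ xSy tψ
    ⊨1-persist (φ ∨' ψ) xSy (inj₁ tφ) = inj₁ (⊨1-persist φ xSy tφ)
    ⊨1-persist (φ ∨' ψ) xSy (inj₂ tψ) = inj₂ (⊨1-persist ψ xSy tψ)

    ⊨0-persist : ∀ {x y} φ → S x y → ⊨0 M x φ → ⊨0 M y φ
    ⊨0-persist (atom p) xSy f = persist0 p xSy f
    ⊨0-persist (¬' φ)   xSy f = ⊨1-persist φ xSy f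
    ⊨0-persist (□ φ)    xSy (u , xRu , fu) =
      let (w , yRw , uSw) = forth xRu xSy in w , yRw , ⊨0-persist φ uSw fu
    ⊨0-persist (φ ∧' ψ) xSy (inj₁ fφ) = inj₁ (⊨0-persist φ xSy fφ)
    ⊨0-persist (φ ∧' ψ) xSy (inj₂ fψ) = inj₂ (⊨0-persist ψ xSy fψ)
    ⊨0-persist (φ ∨' ψ) xSy (fφ , fψ) = ⊨0-persist φ xSy fφ , ⊨0-persist ψ xSy fψ

  refutesSeq-persist : ∀ {x y} s → S x y → RefutesSeq M x s → RefutesSeq M y s
  refutesSeq-persist (Γ ⇒ Δ) xSy (γ , δ) =
    (λ φ φ∈Γ → ⊨1-persist φ xSy (γ φ φ∈Γ)) , (λ φ φ∈Δ → ⊨0-persist φ xSy (δ φ φ∈Δ))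

  refutesFrom-persist : ∀ {x y} s H → S x y → RefutesFrom M x s H → RefutesFrom M y s H
  refutesFrom-persist s []      xSy r = refutesSeq-persist s xSy r
  refutesFrom-persist s (t ∷ H) xSy (r , x' , xRx' , ρ) =
    let (y' , yRy' , x'Sy') = forth xRx' xSy
    in refutesSeq-persist s xSy r , y' , yRy' , refutesFrom-persist t H x'Sy' ρ

  refutesFrom-head : ∀ {w s} H → RefutesFrom M w s H → RefutesSeq M w s
  refutesFrom-head []      r       = r
  refutesFrom-head (_ ∷ _) (r , _) = r

  refutesFrom-mapHead : ∀ {w s s′} H → (RefutesSeq M w s → RefutesSeq M w s′)
                      → RefutesFrom M w s H → RefutesFrom M w s′ H
  refutesFrom-mapHead []      f r       = f r
  refutesFrom-mapHead (_ ∷ _) f (r , ρ) = f r , ρ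

  module _ {S₀ S₁ S₂ : Sequent} {H₀ H₁ H₂ : HS}
           (split : ∀ {w} → RefutesFrom M w S₀ H₀
                          → RefutesFrom M w S₁ H₁ ⊎ RefutesFrom M w S₂ H₂) where

    refutesFrom-split : ∀ {w} g G → RefutesFrom M w g (G ++ S₀ ∷ H₀)
                      → RefutesFrom M w g (G ++ S₁ ∷ H₁) ⊎ RefutesFrom M w g (G ++ S₂ ∷ H₂)
    refutesFrom-split g [] (r , w′ , wRw′ , ρ) =
      ⊎-map (λ ρ′ → r , w′ , wRw′ , ρ′) (λ ρ′ → r , w′ , wRw′ , ρ′) (split ρ)
    refutesFrom-split g (g′ ∷ G) (r , w′ , wRw′ , ρ) =
      ⊎-map (λ ρ′ → r , w′ , wRw′ , ρ′) (λ ρ′ → r , w′ , wRw′ , ρ′) (refutesFrom-split g′ G ρ)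

    countermodel-split : ∀ G → Countermodel M (G ++ S₀ ∷ H₀)
                       → Countermodel M (G ++ S₁ ∷ H₁) ⊎ Countermodel M (G ++ S₂ ∷ H₂)
    countermodel-split []      (w , ρ) = ⊎-map (w ,_) (w ,_) (split ρ)
    countermodel-split (g ∷ G) (w , ρ) = ⊎-map (w ,_) (w ,_) (refutesFrom-split g G ρ)

  countermodel-map : ∀ G {S₀ S₁ H₀ H₁}
                   → (∀ {w} → RefutesFrom M w S₀ H₀ → RefutesFrom M w S₁ H₁)
                   → Countermodel M (G ++ S₀ ∷ H₀) → Countermodel M (G ++ S₁ ∷ H₁)
  countermodel-map G f = reduce ∘ countermodel-split (inj₁ ∘ f) G

  countermodel-mapSeq : ∀ G H {s₀ s₁} → (∀ {w} → RefutesSeq M w s₀ → RefutesSeq M w s₁)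
                      → Countermodel M (G ++ s₀ ∷ H) → Countermodel M (G ++ s₁ ∷ H)
  countermodel-mapSeq G H f = countermodel-map G (refutesFrom-mapHead H f)

  countermodel-splitSeq : ∀ G H {s₀ s₁ s₂}
                        → (∀ {w} → RefutesSeq M w s₀ → RefutesSeq M w s₁ ⊎ RefutesSeq M w s₂)
                        → Countermodel M (G ++ s₀ ∷ H)
                        → Countermodel M (G ++ s₁ ∷ H) ⊎ Countermodel M (G ++ s₂ ∷ H)
  countermodel-splitSeq G H {s₀} {s₁} {s₂} f = countermodel-split splitHead G
    where
    splitHead : ∀ {w} → RefutesFrom M w s₀ H → RefutesFrom M w s₁ H ⊎ RefutesFrom M w s₂ H
    splitHead ρ = ⊎-map (λ r → refutesFrom-mapHead H (λ _ → r) ρ)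
                        (λ r → refutesFrom-mapHead H (λ _ → r) ρ)
                        (f (refutesFrom-head H ρ))

  countermodel-≈H : ∀ G H → G ≈H H → Countermodel M H → Countermodel M G
  countermodel-≈H []      []      []       tt      = tt
  countermodel-≈H (g ∷ G) (h ∷ H) (g≈h ∷ G≈H) (w , ρ) = w , refutesFrom-≈ g h G H g≈h G≈H ρ
    where
    refutesSeq-≈ : ∀ {w} g h → g ≈S h → RefutesSeq M w h → RefutesSeq M w g
    refutesSeq-≈ (_ ⇒ _) (_ ⇒ _) ((Γ⊆Γ′ , _) , (Δ⊆Δ′ , _)) (γ , δ) =
      (λ φ φ∈Γ → γ φ (Γ⊆Γ′ φ∈Γ)) , (λ φ φ∈Δ → δ φ (Δ⊆Δ′ φ∈Δ))

    refutesFrom-≈ : ∀ {w} g h G H → g ≈S h → G ≈H H → RefutesFrom M w h H → RefutesFrom M w g G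
    refutesFrom-≈ g h [] [] g≈h [] r = refutesSeq-≈ g h g≈h r
    refutesFrom-≈ g h (g′ ∷ G) (h′ ∷ H) g≈h (g′≈h′ ∷ G≈H) (r , w′ , wRw′ , ρ) =
      refutesSeq-≈ g h g≈h r , w′ , wRw′ , refutesFrom-≈ g′ h′ G H g′≈h′ G≈H ρ

  emptySequent : Sequent
  emptySequent = [] ⇒ []

  -- A world refuting an empty component is skipped by Pseudo-Transitivity; the
  -- rest of the branch then hangs off an S-successor and is carried over by persistence.
  refutesFrom-dropEmpty : ∀ {w} g G H → RefutesFrom M w g (G ++ emptySequent ∷ H)
                        → RefutesFrom M w g (G ++ H)
  refutesFrom-dropEmpty g []       []      (r , _) = r
  refutesFrom-dropEmpty g []       (h ∷ H) (r , u , wRu , _ , v , uRv , ρ) =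
    let (w′ , wRw′ , vSw′) = pseudoTrans wRu uRv
    in r , w′ , wRw′ , refutesFrom-persist h H vSw′ ρ
  refutesFrom-dropEmpty g (g′ ∷ G) H       (r , w′ , wRw′ , ρ) =
    r , w′ , wRw′ , refutesFrom-dropEmpty g′ G H ρ

  countermodel-dropEmpty : ∀ G H → Countermodel M (G ++ emptySequent ∷ H) → Countermodel M (G ++ H)
  countermodel-dropEmpty []      []      _                   = tt
  countermodel-dropEmpty []      (h ∷ H) (_ , _ , v , _ , ρ) = v , ρ
  countermodel-dropEmpty (g ∷ G) H       (w , ρ)             = w , refutesFrom-dropEmpty g G H ρ

  module _ {w : W} {Γ Δ : List Fml} {φ : Fml} where

    refutes-iwL : RefutesSeq M w ((φ ∷ Γ) ⇒ Δ) → RefutesSeq M w (Γ ⇒ Δ)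
    refutes-iwL (γ , δ) = ∀∈-tail γ , δ

    refutes-iwR : RefutesSeq M w (Γ ⇒ (φ ∷ Δ)) → RefutesSeq M w (Γ ⇒ Δ)
    refutes-iwR (γ , δ) = γ , ∀∈-tail δ

    refutes-¬L : RefutesSeq M w ((¬' φ ∷ Γ) ⇒ Δ) → RefutesSeq M w (Γ ⇒ (φ ∷ Δ))
    refutes-¬L (γ , δ) = ∀∈-tail γ , ∀∈-cons (∀∈-head γ) δ

    refutes-¬R : RefutesSeq M w (Γ ⇒ (¬' φ ∷ Δ)) → RefutesSeq M w ((φ ∷ Γ) ⇒ Δ)
    refutes-¬R (γ , δ) = ∀∈-cons (∀∈-head δ) γ , ∀∈-tail δ

    refutes-∧L : ∀ {ψ} → RefutesSeq M w (((φ ∧' ψ) ∷ Γ) ⇒ Δ) → RefutesSeq M w ((φ ∷ ψ ∷ Γ) ⇒ Δ)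
    refutes-∧L (γ , δ) = let (tφ , tψ) = ∀∈-head γ in ∀∈-cons tφ (∀∈-cons tψ (∀∈-tail γ)) , δ

    refutes-∧R : ∀ {ψ} → RefutesSeq M w (Γ ⇒ ((φ ∧' ψ) ∷ Δ))
               → RefutesSeq M w (Γ ⇒ (φ ∷ Δ)) ⊎ RefutesSeq M w (Γ ⇒ (ψ ∷ Δ))
    refutes-∧R (γ , δ) =
      ⊎-map (λ fφ → γ , ∀∈-cons fφ (∀∈-tail δ)) (λ fψ → γ , ∀∈-cons fψ (∀∈-tail δ)) (∀∈-head δ)

    refutes-∨L : ∀ {ψ} → RefutesSeq M w (((φ ∨' ψ) ∷ Γ) ⇒ Δ)
               → RefutesSeq M w ((φ ∷ Γ) ⇒ Δ) ⊎ RefutesSeq M w ((ψ ∷ Γ) ⇒ Δ)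
    refutes-∨L (γ , δ) =
      ⊎-map (λ tφ → ∀∈-cons tφ (∀∈-tail γ) , δ) (λ tψ → ∀∈-cons tψ (∀∈-tail γ) , δ) (∀∈-head γ)

    refutes-∨R : ∀ {ψ} → RefutesSeq M w (Γ ⇒ ((φ ∨' ψ) ∷ Δ)) → RefutesSeq M w (Γ ⇒ (φ ∷ ψ ∷ Δ))
    refutes-∨R (γ , δ) = let (fφ , fψ) = ∀∈-head δ in γ , ∀∈-cons fφ (∀∈-cons fψ (∀∈-tail δ))

    refutesFrom-□R : RefutesFrom M w (Γ ⇒ (□ φ ∷ Δ)) [] → RefutesFrom M w (Γ ⇒ Δ) [ [] ⇒ [ φ ] ]
    refutesFrom-□R (γ , δ) =
      let (u , wRu , fφ) = ∀∈-head δ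
      in (γ , ∀∈-tail δ) , u , wRu , (λ _ ()) , ∀∈-cons fφ (λ _ ())

    refutesFrom-□L : ∀ {Σ′ Λ H} → RefutesFrom M w ((□ φ ∷ Γ) ⇒ Δ) ((Σ′ ⇒ Λ) ∷ H)
                   → RefutesFrom M w (Γ ⇒ Δ) (((φ ∷ Σ′) ⇒ Λ) ∷ H)
    refutesFrom-□L {H = H} ((γ , δ) , u , wRu , ρ) =
      (∀∈-tail γ , δ) , u , wRu ,
      refutesFrom-mapHead H (λ (σ , λ′) → ∀∈-cons (∀∈-head γ u wRu) σ , λ′) ρ

  refutesFrom-EC : ∀ {w s} H → RefutesFrom M w s H → RefutesFrom M w s (s ∷ H)
  refutesFrom-EC {w} H ρ = refutesFrom-head H ρ , w , R-refl w , ρ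

  sound : ∀ {H} (d : ⊢ H) → CutFree d → Countermodel M H → ⊥
  sound (set-eq {G} {H} G≈H d) cf c = sound d cf (countermodel-≈H G H G≈H c)
  sound (ax p) _ (w , γ , δ) = one≢zero (trans (sym (∀∈-head γ)) (∀∈-head δ))
  sound (cut _ _ _ _ _ _ _) ()
  sound (ewL G d) cf c = sound d cf (countermodel-dropEmpty [] G c)
  sound (ewR G d) cf c =
    sound d cf (subst (Countermodel M) (++-identityʳ G) (countermodel-dropEmpty G [] c))
  sound (iwL G H _ _ _ d) cf c = sound d cf (countermodel-mapSeq G H refutes-iwL c)
  sound (iwR G H _ _ _ d) cf c = sound d cf (countermodel-mapSeq G H refutes-iwR c)
  sound (¬L G H _ _ _ d) cf c = sound d cf (countermodel-mapSeq G H refutes-¬L c)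
  sound (¬R G H _ _ _ d) cf c = sound d cf (countermodel-mapSeq G H refutes-¬R c)
  sound (∧L G H _ _ _ _ d) cf c = sound d cf (countermodel-mapSeq G H refutes-∧L c)
  sound (∧R G H _ _ _ _ d d′) (cf , cf′) c with countermodel-splitSeq G H refutes-∧R c
  ... | inj₁ c₁ = sound d cf c₁
  ... | inj₂ c₂ = sound d′ cf′ c₂
  sound (∨L G H _ _ _ _ d d′) (cf , cf′) c with countermodel-splitSeq G H refutes-∨L c
  ... | inj₁ c₁ = sound d cf c₁
  ... | inj₂ c₂ = sound d′ cf′ c₂
  sound (∨R G H _ _ _ _ d) cf c = sound d cf (countermodel-mapSeq G H refutes-∨R c)
  sound (□R G _ _ _ d) cf c = sound d cf (countermodel-map G refutesFrom-□R c)
  sound (□L G _ _ _ _ _ _ d) cf c = sound d cf (countermodel-map G refutesFrom-□L c)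
  sound (EC G H _ _ d) cf c = sound d cf (countermodel-map G (refutesFrom-EC H) c)
  sound (EW G H d) cf c = sound d cf (countermodel-dropEmpty G H c)

mainTheorem6 : ∀ (H : HS) → Σ (⊢ H) CutFree → PS4Valid H
mainTheorem6 H (d , cf) M = Soundness.sound M d cf
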